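{- Let $G_0$ be a stepwise irregular graph of order $n$ and cyclomatic number $\gamma$ possessing a vertex of degree $2$ both of whose neighbours have degree $3$. Then for every $k=1,2,\dots$ there exists a stepwise irregular graph of order $n+4k+3$ and cyclomatic number $\gamma+1$.
   Context: All graphs are finite and simple. A graph $G$ is stepwise irregular (SI) if for every edge $uv\in E(G)$ one has $|d_G(u)-d_G(v)|=1$, where $d_G$ denotes degree. The order of a graph is its number of vertices. The cyclomatic number of a connected graph with $n$ vertices and $m$ edges is $\gamma=m-n+1$. -}

module Defs where

open import Data.Nat using (ℕ; zero; suc; _+_; _<ᵇ_)
open import Data.Bool using (Bool; true; false; _∧_; if_then_else_)
open import Data.Fin using (Fin; toℕ)
open import Data.List using (List; allFin; filter; length; map)
open import Data.Nat.ListAction using (sum)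
open import Data.Bool.Properties using (T?)
open import Data.Integer using (ℤ; +_; _-_)
open import Data.Product using (_×_; Σ; ∃; _,_)
import Data.Sum
import Data.Integer
open import Relation.Binary.PropositionalEquality using (_≡_)

record Graph (n : ℕ) : Set where
  field
    adj   : Fin n → Fin n → Bool
    sym   : ∀ u v → adj u v ≡ adj v u
    irrefl : ∀ v → adj v v ≡ false
open Graph public

countB : ∀ {A : Set} → (A → Bool) → List A → ℕ
countB p xs = length (filter (λ x → T? (p x)) xs)

deg : ∀ {n} → Graph n → Fin n → ℕ
deg {n} G v = countB (adj G v) (allFin n)

edges : ∀ {n} → Graph n → ℕ
edges {n} G = sum (map (λ u → countB (λ v → (toℕ u <ᵇ toℕ v) ∧ adj G u v) (allFin n)) (allFin n))

Adj : ∀ {n} → Graph n → Fin n → Fin n → Set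
Adj G u v = adj G u v ≡ true

data Reach {n} (G : Graph n) : Fin n → Fin n → Set where
  here : ∀ {v} → Reach G v v
  step : ∀ {u w v} → Adj G u w → Reach G w v → Reach G u v

Connected : ∀ {n} → Graph n → Set
Connected {n} G = ∀ (u v : Fin n) → Reach G u v

-- cyclomatic number m - n + 1 (meaningful for connected graphs)
cyclomatic : ∀ {n} → Graph n → ℤ
cyclomatic {n} G = (+ edges G) - (+ n) Data.Integer.+ (+ 1)

StepwiseIrregular : ∀ {n} → Graph n → Set
StepwiseIrregular G = ∀ u v → Adj G u v → (deg G u ≡ suc (deg G v)) Data.Sum.⊎ (deg G v ≡ suc (deg G u))

module Submission where

open import Defs
open import Data.Nat using (ℕ; suc; _+_; _*_)
open import Data.Integer using (ℤ; +_)
open import Data.Fin using (Fin)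
open import Data.Product using (Σ; ∃; _×_; _,_)
open import Relation.Binary.PropositionalEquality using (_≡_)
import Data.Nat
import Data.Integer

open import Data.Nat using (zero; _<ᵇ_)
open import Data.Nat.Tactic.RingSolver using () renaming (solve-∀ to ℕ-solve)
import Data.Integer as ℤ
open import Data.Integer.Properties using (pos-+; +-identityʳ)
open import Data.Integer.Tactic.RingSolver using () renaming (solve-∀ to ℤ-solve)
open import Data.Fin using (zero; suc; toℕ; _≟_)
open import Data.Bool using (Bool; true; false; _∧_)
open import Data.List using (List; []; _∷_; allFin; map; tabulate)
open import Data.List.Properties using (map-tabulate; map-cong)
open import Data.Nat.ListAction using (sum)
open import Data.Sum using (_⊎_; inj₁; inj₂)
open import Data.Empty using (⊥-elim)
open import Relation.Nullary using (yes; no; does)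
open import Function using (_∘_; id)
open import Relation.Binary.PropositionalEquality
  using (refl; trans; cong; cong₂; subst; _≢_; module ≡-Reasoning) renaming (sym to ≡-sym)

-- Call a connected graph H with cyclomatic
-- number γ "stepwise irregular up to two defects v, t" if every edge avoiding
-- v and t is stepwise, v has degree 3 and all its neighbours have degree 3,
-- and t ≠ v has degree 2 and all its neighbours other than v have degree 2.
--  * Start: hanging a path of 3 new vertices at the degree-2 vertex v of G₀
--    gives such a graph with 3 more vertices (t is the first path vertex).
--  * Regular step: hanging a path of 4 new vertices at t moves the defect t
--    into the new path; order grows by 4, γ is unchanged.
--  * Closing step: a new vertex c at t, a new vertex d joined to c and to v
--    (this closes a cycle, so γ grows by 1), and a path of 2 vertices at d.
--    Then v, t, d get degrees 4, 3, 3 and the graph is stepwise irregular.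

bit : Bool → ℕ
bit true = 1
bit false = 0

countB-as-sum : ∀ {A : Set} (p : A → Bool) xs → countB p xs ≡ sum (map (bit ∘ p) xs)
countB-as-sum p [] = refl
countB-as-sum p (x ∷ xs) with p x
... | true = cong suc (countB-as-sum p xs)
... | false = countB-as-sum p xs

sum-suc : ∀ {N} (f : Fin (suc N) → ℕ) → sum (map f (allFin (suc N))) ≡ f zero + sum (map (f ∘ suc) (allFin N))
sum-suc {N} f = cong (λ xs → f zero + sum xs)
  (trans (map-tabulate suc f) (≡-sym (map-tabulate id (f ∘ suc))))

countB-suc : ∀ {N} (p : Fin (suc N) → Bool) → countB p (allFin (suc N)) ≡ bit (p zero) + countB (p ∘ suc) (allFin N)
countB-suc {N} p = begin
  countB p (allFin (suc N))                            ≡⟨ countB-as-sum p (allFin (suc N)) ⟩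
  sum (map (bit ∘ p) (allFin (suc N)))                 ≡⟨ sum-suc (bit ∘ p) ⟩
  bit (p zero) + sum (map (bit ∘ p ∘ suc) (allFin N))  ≡⟨ cong (λ c → bit (p zero) + c) (≡-sym (countB-as-sum (p ∘ suc) (allFin N))) ⟩
  bit (p zero) + countB (p ∘ suc) (allFin N)           ∎
  where open ≡-Reasoning

countB-false : ∀ {A : Set} (xs : List A) → countB (λ _ → false) xs ≡ 0
countB-false [] = refl
countB-false (x ∷ xs) = countB-false xs

only : ∀ {N} → Fin N → Fin N → Bool
only a w = does (w ≟ a)

only-self : ∀ {N} (a : Fin N) → only a a ≡ true
only-self a with a ≟ a
... | yes _ = refl
... | no a≢a = ⊥-elim (a≢a refl)

only-other : ∀ {N} {a w : Fin N} → w ≢ a → only a w ≡ false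
only-other {a = a} {w} w≢a with w ≟ a
... | yes w≡a = ⊥-elim (w≢a w≡a)
... | no _ = refl

only-true : ∀ {N} (a w : Fin N) → only a w ≡ true → w ≡ a
only-true a w _ with w ≟ a
... | yes w≡a = w≡a
only-true a w () | no _

count-only : ∀ {N} (a : Fin N) → countB (only a) (allFin N) ≡ 1
count-only {suc N} zero = trans (countB-suc {N} (only zero)) (cong suc (countB-false (allFin N)))
count-only {suc N} (suc a) = trans (countB-suc {N} (only (suc a))) (count-only a)

adj-sym : ∀ {N} (H : Graph N) {u w} → Adj H u w → Adj H w u
adj-sym H {u} {w} a = trans (Graph.sym H w u) a

adj-≢ : ∀ {N} (H : Graph N) {u w} → Adj H u w → u ≢ w
adj-≢ H {u} a refl with trans (≡-sym a) (Graph.irrefl H u)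
... | ()

-- Adding a vertex.  addVertex H s is H together with a new vertex, numbered
-- zero, adjacent exactly to the vertices in s; old vertex w becomes suc w.
addAdj : ∀ {N} → Graph N → (Fin N → Bool) → Fin (suc N) → Fin (suc N) → Bool
addAdj H s zero zero = false
addAdj H s zero (suc w) = s w
addAdj H s (suc u) zero = s u
addAdj H s (suc u) (suc w) = adj H u w

addVertex : ∀ {N} → Graph N → (Fin N → Bool) → Graph (suc N)
addVertex H s = record { adj = addAdj H s ; sym = symmetric ; irrefl = irreflexive }
  where
  symmetric : ∀ u w → addAdj H s u w ≡ addAdj H s w u
  symmetric zero zero = refl
  symmetric zero (suc w) = refl
  symmetric (suc u) zero = refl
  symmetric (suc u) (suc w) = Graph.sym H u w
  irreflexive : ∀ w → addAdj H s w w ≡ false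
  irreflexive zero = refl
  irreflexive (suc w) = Graph.irrefl H w

deg-new : ∀ {N} (H : Graph N) s → deg (addVertex H s) zero ≡ countB s (allFin N)
deg-new {N} H s = countB-suc {N} (addAdj H s zero)

deg-old : ∀ {N} (H : Graph N) s w → deg (addVertex H s) (suc w) ≡ bit (s w) + deg H w
deg-old {N} H s w = countB-suc {N} (addAdj H s (suc w))

forward : ∀ {M} → Graph M → Fin M → ℕ
forward {M} G u = countB (λ w → (toℕ u <ᵇ toℕ w) ∧ adj G u w) (allFin M)

edges-add : ∀ {N} (H : Graph N) s → edges (addVertex H s) ≡ countB s (allFin N) + edges H
edges-add {N} H s = trans (sum-suc {N} (forward (addVertex H s)))
  (cong₂ _+_ (countB-suc {N} (λ w → (0 <ᵇ toℕ w) ∧ addAdj H s zero w))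
             (cong sum (map-cong (λ u → countB-suc {N} (λ w → (suc (toℕ u) <ᵇ toℕ w) ∧ addAdj H s (suc u) w)) (allFin N))))

lift-reach : ∀ {N} (H : Graph N) s {u w} → Reach H u w → Reach (addVertex H s) (suc u) (suc w)
lift-reach H s here = here
lift-reach H s (step e r) = step e (lift-reach H s r)

conn-add : ∀ {N} (H : Graph N) s a → s a ≡ true → Connected H → Connected (addVertex H s)
conn-add H s a sa c zero zero = here
conn-add H s a sa c zero (suc w) = step sa (lift-reach H s (c a w))
conn-add H s a sa c (suc u) zero = into-new (lift-reach H s (c u a))
  where
  into-new : ∀ {x} → Reach (addVertex H s) x (suc a) → Reach (addVertex H s) x zero
  into-new here = step sa here
  into-new (step e r) = step e (into-new r)
conn-add H s a sa c (suc u) (suc w) = lift-reach H s (c u w)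

cyc-add : ∀ {N} (H : Graph N) s → cyclomatic (addVertex H s) ≡ cyclomatic H ℤ.+ (+ countB s (allFin N) ℤ.- + 1)
cyc-add {N} H s rewrite edges-add H s | pos-+ (countB s (allFin N)) (edges H) | pos-+ 1 N =
  shuffle (+ countB s (allFin N)) (+ edges H) (+ N)
  where
  shuffle : ∀ c e n → c ℤ.+ e ℤ.- (+ 1 ℤ.+ n) ℤ.+ + 1 ≡ e ℤ.- n ℤ.+ + 1 ℤ.+ (c ℤ.- + 1)
  shuffle = ℤ-solve

pendant : ∀ {N} → Graph N → Fin N → Graph (suc N)
pendant H a = addVertex H (only a)

deg-leaf : ∀ {N} (H : Graph N) a → deg (pendant H a) zero ≡ 1
deg-leaf H a = trans (deg-new H (only a)) (count-only a)

deg-anchor : ∀ {N} (H : Graph N) a → deg (pendant H a) (suc a) ≡ suc (deg H a)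
deg-anchor H a = trans (deg-old H (only a) a) (cong (λ b → bit b + deg H a) (only-self a))

deg-unchanged : ∀ {N} (H : Graph N) a w → w ≢ a → deg (pendant H a) (suc w) ≡ deg H w
deg-unchanged H a w w≢a = trans (deg-old H (only a) w) (cong (λ b → bit b + deg H w) (only-other w≢a))

conn-pendant : ∀ {N} (H : Graph N) a → Connected H → Connected (pendant H a)
conn-pendant H a = conn-add H (only a) a (only-self a)

cyc-pendant : ∀ {N} (H : Graph N) a → cyclomatic (pendant H a) ≡ cyclomatic H
cyc-pendant {N} H a = begin
  cyclomatic (pendant H a)                                  ≡⟨ cyc-add H (only a) ⟩
  cyclomatic H ℤ.+ (+ countB (only a) (allFin N) ℤ.- + 1)  ≡⟨ cong (λ c → cyclomatic H ℤ.+ (+ c ℤ.- + 1)) (count-only a) ⟩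
  cyclomatic H ℤ.+ + 0                                      ≡⟨ +-identityʳ (cyclomatic H) ⟩
  cyclomatic H                                              ∎
  where open ≡-Reasoning

Step : ℕ → ℕ → Set
Step x y = (x ≡ suc y) ⊎ (y ≡ suc x)

Step-sym : ∀ {x y} → Step x y → Step y x
Step-sym (inj₁ p) = inj₂ p
Step-sym (inj₂ p) = inj₁ p

Step-resp : ∀ {x y x' y'} → x ≡ x' → y ≡ y' → Step x' y' → Step x y
Step-resp refl refl s = s

record TwoDefects {N} (H : Graph N) (v t : Fin N) (γ : ℤ) : Set where
  field
    connected : Connected H
    cyclo : cyclomatic H ≡ γ
    deg-v : deg H v ≡ 3
    deg-t : deg H t ≡ 2
    t≢v : t ≢ v
    stepwise : ∀ u w → Adj H u w → u ≢ v → u ≢ t → w ≢ v → w ≢ t → Step (deg H u) (deg H w)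
    nbrs-v : ∀ u → Adj H v u → u ≢ t → deg H u ≡ 3
    nbrs-t : ∀ u → Adj H t u → u ≢ v → deg H u ≡ 2

-- If the degree of t is raised to 3 and all degrees
-- outside v, t are kept, then every edge avoiding v becomes stepwise, and all
-- neighbours of v have degree 3.  D is the degree function of the enlarged
-- graph, restricted to the old vertices.
module RaiseT {N} {H : Graph N} {v t γ} (I : TwoDefects H v t γ) (D : Fin N → ℕ)
              (D-t : D t ≡ 3) (D-other : ∀ w → w ≢ v → w ≢ t → D w ≡ deg H w) where
  open TwoDefects I

  from-t : ∀ w → Adj H t w → w ≢ v → Step (D t) (D w)
  from-t w e w≢v = Step-resp D-t (trans (D-other w w≢v (λ w≡t → adj-≢ H e (≡-sym w≡t))) (nbrs-t w e w≢v)) (inj₁ refl)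

  edge-avoiding-v : ∀ u w → Adj H u w → u ≢ v → w ≢ v → Step (D u) (D w)
  edge-avoiding-v u w e u≢v w≢v with u ≟ t | w ≟ t
  ... | yes refl | _ = from-t w e w≢v
  ... | no _ | yes refl = Step-sym (from-t u (adj-sym H e) u≢v)
  ... | no u≢t | no w≢t = Step-resp (D-other u u≢v u≢t) (D-other w w≢v w≢t) (stepwise u w e u≢v u≢t w≢v w≢t)

  nbr-v : ∀ w → Adj H v w → D w ≡ 3
  nbr-v w e with w ≟ t
  ... | yes refl = D-t
  ... | no w≢t = trans (D-other w (λ w≡v → adj-≢ H e (≡-sym w≡v)) w≢t) (nbrs-v w e w≢t)

  -- If moreover the degree of v is raised to 4, every edge of H is stepwise:
  -- edges at v join degrees 4 and 3, the others are handled above.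
  every-edge : D v ≡ 4 → ∀ u w → Adj H u w → Step (D u) (D w)
  every-edge D-v u w e with u ≟ v | w ≟ v
  ... | yes refl | _ = Step-resp D-v (nbr-v w e) (inj₁ refl)
  ... | no _ | yes refl = Step-resp (nbr-v u (adj-sym H e)) D-v (inj₂ refl)
  ... | no u≢v | no w≢v = edge-avoiding-v u w e u≢v w≢v

-- Start: a path q – p – c hung at the degree-2 vertex v of G₀, with c ~ v.
-- Vertices: q = 0, p = 1, c = 2, old w = 3 + w; the defects are v and c.
module Start {n} {G₀ : Graph n} {γ} (conn : Connected G₀) (si : StepwiseIrregular G₀) (cyc : cyclomatic G₀ ≡ γ)
             {v : Fin n} (deg-v : deg G₀ v ≡ 2) (nbrs : ∀ u → Adj G₀ v u → deg G₀ u ≡ 3) where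
  J₁ : Graph (1 + n)
  J₁ = pendant G₀ v
  J₂ : Graph (2 + n)
  J₂ = pendant J₁ zero
  graph : Graph (3 + n)
  graph = pendant J₂ zero

  old : Fin n → Fin (3 + n)
  old w = suc (suc (suc w))

  deg-old-vertex : ∀ w → deg graph (old w) ≡ deg J₁ (suc w)
  deg-old-vertex w = trans (deg-unchanged J₂ zero (suc (suc w)) λ ()) (deg-unchanged J₁ zero (suc w) λ ())

  deg-kept : ∀ w → w ≢ v → deg graph (old w) ≡ deg G₀ w
  deg-kept w w≢v = trans (deg-old-vertex w) (deg-unchanged G₀ v w w≢v)

  old-≢ : ∀ {u w} → old u ≢ old w → u ≢ w
  old-≢ ne u≡w = ne (cong old u≡w)

  deg-q : deg graph zero ≡ 1
  deg-q = deg-leaf J₂ zero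
  deg-p : deg graph (suc zero) ≡ 2
  deg-p = trans (deg-anchor J₂ zero) (cong suc (deg-leaf J₁ zero))
  deg-c : deg graph (suc (suc zero)) ≡ 2
  deg-c = trans (deg-unchanged J₂ zero (suc zero) λ ()) (trans (deg-anchor J₁ zero) (cong suc (deg-leaf G₀ v)))

  stepwise : ∀ u w → Adj graph u w → u ≢ old v → u ≢ suc (suc zero) → w ≢ old v → w ≢ suc (suc zero)
             → Step (deg graph u) (deg graph w)
  stepwise zero (suc zero) e _ _ _ _ = Step-resp deg-q deg-p (inj₂ refl)
  stepwise (suc zero) zero e _ _ _ _ = Step-resp deg-p deg-q (inj₁ refl)
  stepwise (suc zero) (suc (suc zero)) e _ _ _ w≢c = ⊥-elim (w≢c refl)
  stepwise (suc (suc zero)) w e _ u≢c _ _ = ⊥-elim (u≢c refl)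
  stepwise (suc (suc (suc u))) (suc (suc zero)) e _ _ _ w≢c = ⊥-elim (w≢c refl)
  stepwise (suc (suc (suc u))) (suc (suc (suc w))) e u≢v _ w≢v _ =
    Step-resp (deg-kept u (old-≢ u≢v)) (deg-kept w (old-≢ w≢v)) (si u w e)

  nbrs-v : ∀ u → Adj graph (old v) u → u ≢ suc (suc zero) → deg graph u ≡ 3
  nbrs-v (suc (suc zero)) e u≢c = ⊥-elim (u≢c refl)
  nbrs-v (suc (suc (suc u))) e _ = trans (deg-kept u (λ u≡v → adj-≢ G₀ e (≡-sym u≡v))) (nbrs u e)

  nbrs-c : ∀ u → Adj graph (suc (suc zero)) u → u ≢ old v → deg graph u ≡ 2
  nbrs-c (suc zero) e _ = deg-p
  nbrs-c (suc (suc (suc u))) e u≢v = ⊥-elim (u≢v (cong old (only-true v u e)))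

  defects : TwoDefects graph (old v) (suc (suc zero)) γ
  defects = record
    { connected = conn-pendant J₂ zero (conn-pendant J₁ zero (conn-pendant G₀ v conn))
    ; cyclo = trans (cyc-pendant J₂ zero) (trans (cyc-pendant J₁ zero) (trans (cyc-pendant G₀ v) cyc))
    ; deg-v = trans (deg-old-vertex v) (trans (deg-anchor G₀ v) (cong suc deg-v))
    ; deg-t = deg-c
    ; t≢v = λ ()
    ; stepwise = stepwise
    ; nbrs-v = nbrs-v
    ; nbrs-t = nbrs-c }

-- Regular step: a path q – p – d – c hung at t, with c ~ t.  Vertices:
-- q = 0, p = 1, d = 2, c = 3, old w = 4 + w; the new defects are v and d.
module Regular {N} {H : Graph N} {v t γ} (I : TwoDefects H v t γ) where
  open TwoDefects I
  G₁ : Graph (1 + N)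
  G₁ = pendant H t
  G₂ : Graph (2 + N)
  G₂ = pendant G₁ zero
  G₃ : Graph (3 + N)
  G₃ = pendant G₂ zero
  graph : Graph (4 + N)
  graph = pendant G₃ zero

  old : Fin N → Fin (4 + N)
  old w = suc (suc (suc (suc w)))

  D : Fin N → ℕ
  D w = deg graph (old w)

  deg-old-vertex : ∀ w → D w ≡ deg G₁ (suc w)
  deg-old-vertex w = trans (deg-unchanged G₃ zero (suc (suc (suc w))) λ ())
                     (trans (deg-unchanged G₂ zero (suc (suc w)) λ ()) (deg-unchanged G₁ zero (suc w) λ ()))

  D-t : D t ≡ 3
  D-t = trans (deg-old-vertex t) (trans (deg-anchor H t) (cong suc deg-t))

  D-kept : ∀ w → w ≢ t → D w ≡ deg H w
  D-kept w w≢t = trans (deg-old-vertex w) (deg-unchanged H t w w≢t)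

  open RaiseT I D D-t (λ w _ → D-kept w)

  deg-q : deg graph zero ≡ 1
  deg-q = deg-leaf G₃ zero
  deg-p : deg graph (suc zero) ≡ 2
  deg-p = trans (deg-anchor G₃ zero) (cong suc (deg-leaf G₂ zero))
  deg-d : deg graph (suc (suc zero)) ≡ 2
  deg-d = trans (deg-unchanged G₃ zero (suc zero) λ ()) (trans (deg-anchor G₂ zero) (cong suc (deg-leaf G₁ zero)))
  deg-c : deg graph (suc (suc (suc zero))) ≡ 2
  deg-c = trans (deg-unchanged G₃ zero (suc (suc zero)) λ ())
          (trans (deg-unchanged G₂ zero (suc zero) λ ()) (trans (deg-anchor G₁ zero) (cong suc (deg-leaf H t))))

  stepwise′ : ∀ u w → Adj graph u w → u ≢ old v → u ≢ suc (suc zero) → w ≢ old v → w ≢ suc (suc zero)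
              → Step (deg graph u) (deg graph w)
  stepwise′ zero (suc zero) e _ _ _ _ = Step-resp deg-q deg-p (inj₂ refl)
  stepwise′ (suc zero) zero e _ _ _ _ = Step-resp deg-p deg-q (inj₁ refl)
  stepwise′ (suc zero) (suc (suc zero)) e _ _ _ w≢d = ⊥-elim (w≢d refl)
  stepwise′ (suc (suc zero)) w e _ u≢d _ _ = ⊥-elim (u≢d refl)
  stepwise′ (suc (suc (suc zero))) (suc (suc zero)) e _ _ _ w≢d = ⊥-elim (w≢d refl)
  stepwise′ (suc (suc (suc zero))) (suc (suc (suc (suc w)))) e _ _ _ _ with only-true t w e
  ... | refl = Step-resp deg-c D-t (inj₂ refl)
  stepwise′ (suc (suc (suc (suc u)))) (suc (suc (suc zero))) e _ _ _ _ with only-true t u e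
  ... | refl = Step-resp D-t deg-c (inj₁ refl)
  stepwise′ (suc (suc (suc (suc u)))) (suc (suc (suc (suc w)))) e u≢v _ w≢v _ =
    edge-avoiding-v u w e (λ u≡v → u≢v (cong old u≡v)) (λ w≡v → w≢v (cong old w≡v))

  nbrs-v′ : ∀ u → Adj graph (old v) u → u ≢ suc (suc zero) → deg graph u ≡ 3
  nbrs-v′ (suc (suc (suc zero))) e _ = ⊥-elim (t≢v (≡-sym (only-true t v e)))
  nbrs-v′ (suc (suc (suc (suc u)))) e _ = nbr-v u e

  nbrs-d : ∀ u → Adj graph (suc (suc zero)) u → u ≢ old v → deg graph u ≡ 2
  nbrs-d (suc zero) e _ = deg-p
  nbrs-d (suc (suc (suc zero))) e _ = deg-c

  defects : TwoDefects graph (old v) (suc (suc zero)) γ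
  defects = record
    { connected = conn-pendant G₃ zero (conn-pendant G₂ zero (conn-pendant G₁ zero (conn-pendant H t connected)))
    ; cyclo = trans (cyc-pendant G₃ zero) (trans (cyc-pendant G₂ zero) (trans (cyc-pendant G₁ zero) (trans (cyc-pendant H t) cyclo)))
    ; deg-v = trans (D-kept v (λ v≡t → t≢v (≡-sym v≡t))) deg-v
    ; deg-t = deg-d
    ; t≢v = λ ()
    ; stepwise = stepwise′
    ; nbrs-v = nbrs-v′
    ; nbrs-t = nbrs-d }

newAnd : ∀ {N} → Fin N → Fin (suc N) → Bool
newAnd v zero = true
newAnd v (suc w) = only v w

count-newAnd : ∀ {N} (v : Fin N) → countB (newAnd v) (allFin (suc N)) ≡ 2
count-newAnd {N} v = trans (countB-suc {N} (newAnd v)) (cong suc (count-only v))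

-- Closing step: c ~ t, then d ~ c, v, then a path q – p hung at d.
-- Vertices: q = 0, p = 1, d = 2, c = 3, old w = 4 + w.  Degrees of v, t, d
-- become 4, 3, 3, which removes both defects; the edge d v closes a cycle.
module Close {N} {H : Graph N} {v t γ} (I : TwoDefects H v t γ) where
  open TwoDefects I
  F₁ : Graph (1 + N)
  F₁ = pendant H t
  F₂ : Graph (2 + N)
  F₂ = addVertex F₁ (newAnd v)
  F₃ : Graph (3 + N)
  F₃ = pendant F₂ zero
  graph : Graph (4 + N)
  graph = pendant F₃ zero

  old : Fin N → Fin (4 + N)
  old w = suc (suc (suc (suc w)))

  D : Fin N → ℕ
  D w = deg graph (old w)

  deg-old-vertex : ∀ w → D w ≡ bit (only v w) + deg F₁ (suc w)
  deg-old-vertex w = trans (deg-unchanged F₃ zero (suc (suc (suc w))) λ ())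
                     (trans (deg-unchanged F₂ zero (suc (suc w)) λ ()) (deg-old F₁ (newAnd v) (suc w)))

  D-v : D v ≡ 4
  D-v = trans (deg-old-vertex v)
        (cong₂ (λ b d → bit b + d) (only-self v) (trans (deg-unchanged H t v (λ v≡t → t≢v (≡-sym v≡t))) deg-v))

  D-t : D t ≡ 3
  D-t = trans (deg-old-vertex t)
        (cong₂ (λ b d → bit b + d) (only-other t≢v) (trans (deg-anchor H t) (cong suc deg-t)))

  D-other : ∀ w → w ≢ v → w ≢ t → D w ≡ deg H w
  D-other w w≢v w≢t = trans (deg-old-vertex w)
                      (cong₂ (λ b d → bit b + d) (only-other w≢v) (deg-unchanged H t w w≢t))

  open RaiseT I D D-t D-other

  deg-q : deg graph zero ≡ 1
  deg-q = deg-leaf F₃ zero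
  deg-p : deg graph (suc zero) ≡ 2
  deg-p = trans (deg-anchor F₃ zero) (cong suc (deg-leaf F₂ zero))
  deg-d : deg graph (suc (suc zero)) ≡ 3
  deg-d = trans (deg-unchanged F₃ zero (suc zero) λ ())
          (trans (deg-anchor F₂ zero) (cong suc (trans (deg-new F₁ (newAnd v)) (count-newAnd v))))
  deg-c : deg graph (suc (suc (suc zero))) ≡ 2
  deg-c = trans (deg-unchanged F₃ zero (suc (suc zero)) λ ())
          (trans (deg-unchanged F₂ zero (suc zero) λ ()) (trans (deg-old F₁ (newAnd v) zero) (cong suc (deg-leaf H t))))

  -- New edges have degrees 1–2, 2–3, 3–2, 3–4 (d v) and 2–3 (c t).
  stepwise-irregular : StepwiseIrregular graph
  stepwise-irregular zero (suc zero) e = Step-resp deg-q deg-p (inj₂ refl)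
  stepwise-irregular (suc zero) zero e = Step-resp deg-p deg-q (inj₁ refl)
  stepwise-irregular (suc zero) (suc (suc zero)) e = Step-resp deg-p deg-d (inj₂ refl)
  stepwise-irregular (suc (suc zero)) (suc zero) e = Step-resp deg-d deg-p (inj₁ refl)
  stepwise-irregular (suc (suc zero)) (suc (suc (suc zero))) e = Step-resp deg-d deg-c (inj₁ refl)
  stepwise-irregular (suc (suc (suc zero))) (suc (suc zero)) e = Step-resp deg-c deg-d (inj₂ refl)
  stepwise-irregular (suc (suc zero)) (suc (suc (suc (suc w)))) e with only-true v w e
  ... | refl = Step-resp deg-d D-v (inj₂ refl)
  stepwise-irregular (suc (suc (suc (suc u)))) (suc (suc zero)) e with only-true v u e
  ... | refl = Step-resp D-v deg-d (inj₁ refl)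
  stepwise-irregular (suc (suc (suc zero))) (suc (suc (suc (suc w)))) e with only-true t w e
  ... | refl = Step-resp deg-c D-t (inj₂ refl)
  stepwise-irregular (suc (suc (suc (suc u)))) (suc (suc (suc zero))) e with only-true t u e
  ... | refl = Step-resp D-t deg-c (inj₁ refl)
  stepwise-irregular (suc (suc (suc (suc u)))) (suc (suc (suc (suc w)))) e = every-edge D-v u w e

  connected′ : Connected graph
  connected′ = conn-pendant F₃ zero (conn-pendant F₂ zero (conn-add F₁ (newAnd v) zero refl (conn-pendant H t connected)))

  cyclo′ : cyclomatic graph ≡ γ ℤ.+ + 1
  cyclo′ = begin
    cyclomatic graph                                       ≡⟨ trans (cyc-pendant F₃ zero) (cyc-pendant F₂ zero) ⟩
    cyclomatic F₂                                          ≡⟨ cyc-add F₁ (newAnd v) ⟩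
    cyclomatic F₁ ℤ.+ (+ countB (newAnd v) (allFin (suc N)) ℤ.- + 1)
                                                           ≡⟨ cong (λ c → cyclomatic F₁ ℤ.+ (+ c ℤ.- + 1)) (count-newAnd v) ⟩
    cyclomatic F₁ ℤ.+ + 1                                  ≡⟨ cong (ℤ._+ + 1) (trans (cyc-pendant H t) cyclo) ⟩
    γ ℤ.+ + 1                                              ∎
    where open ≡-Reasoning

Witness : ℕ → ℤ → Set
Witness M γ = Σ (Graph M) λ G → Connected G × StepwiseIrregular G × cyclomatic G ≡ γ ℤ.+ + 1

close : ∀ {N} {H : Graph N} {v t γ} → TwoDefects H v t γ → Witness (4 + N) γ
close I = Close.graph I , Close.connected′ I , Close.stepwise-irregular I , Close.cyclo′ I

-- k regular steps followed by the closing step add 4k + 4 vertices.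
iterate : ∀ k {N} {H : Graph N} {v t γ} → TwoDefects H v t γ → Witness (4 * suc k + N) γ
iterate zero I = close I
iterate (suc k) {N} {γ = γ} I = subst (λ M → Witness M γ) (order k N) (iterate k (Regular.defects I))
  where
  order : ∀ k N → 4 * suc k + (4 + N) ≡ 4 * suc (suc k) + N
  order = ℕ-solve

-- The start adds 3 vertices, then k - 1 regular steps and the closing step
-- add 4k more.
mainTheorem9 : ∀ (n : ℕ) (γ : ℤ) (G₀ : Graph n) → Connected G₀ → StepwiseIrregular G₀ → cyclomatic G₀ ≡ γ
                 → (Σ (Fin n) λ v → deg G₀ v ≡ 2 × (∀ u → Adj G₀ v u → deg G₀ u ≡ 3))
                 → ∀ (k : ℕ) → 1 Data.Nat.≤ k
                 → Σ (Graph (n + 4 * k + 3)) λ G → Connected G × StepwiseIrregular G × cyclomatic G ≡ γ Data.Integer.+ + 1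
mainTheorem9 n γ G₀ conn si cyc (v , deg-v , nbrs) (suc k) _ =
  subst (λ M → Witness M γ) (order k n) (iterate k (Start.defects conn si cyc deg-v nbrs))
  where
  order : ∀ k n → 4 * suc k + (3 + n) ≡ n + 4 * suc k + 3
  order = ℕ-solve
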